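{- For each $n\ge 3$ there is a tight irreducible subcube partition of $\{0,1\}^n$ of size $2n-1$.
   Context: Subcubes of $\{0,1\}^n$ are sets fixing some coordinates to given bits, identified with words in $\{0,1,*\}^n$. A subcube partition of length $n$ is a partition of $\{0,1\}^n$ into subcubes; its size is the number of subcubes. It is irreducible if there is no subset $G$ with $1<|G|<|F|$ whose union is a subcube. It is tight if for every coordinate $i\in[n]$ some subcube $s$ in it has $s_i\ne *$. -}

module Defs where

open import Data.Nat using (ℕ; _<_)
open import Data.Bool using (Bool)
open import Data.Fin using (Fin)
open import Data.Fin.Subset using (Subset; _∈_; ∣_∣)
open import Data.Product using (Σ; _×_; ∃; ∃-syntax)
open import Data.Unit using (⊤)
open import Data.Empty using (⊥)
open import Relation.Binary.PropositionalEquality using (_≡_; _≢_)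
open import Function.Bundles using (_⇔_)

data Sym : Set where
  bit  : Bool → Sym
  star : Sym

Subcube : ℕ → Set
Subcube n = Fin n → Sym

Point : ℕ → Set
Point n = Fin n → Bool

MatchesSym : Bool → Sym → Set
MatchesSym b (bit c) = b ≡ c
MatchesSym b star    = ⊤

_∈ᶜ_ : ∀ {n} → Point n → Subcube n → Set
x ∈ᶜ s = ∀ i → MatchesSym (x i) (s i)

IsSubcubePartition : ∀ {n m} → (Fin m → Subcube n) → Set
IsSubcubePartition {n} {m} F =
  ∀ (x : Point n) → Σ (Fin m) λ j → (x ∈ᶜ F j) × (∀ k → x ∈ᶜ F k → k ≡ j)

UnionIsSubcube : ∀ {n m} → (Fin m → Subcube n) → Subset m → Set
UnionIsSubcube {n} {m} F G =
  Σ (Subcube n) λ s → ∀ (x : Point n) → (x ∈ᶜ s) ⇔ (∃[ j ] (j ∈ G × x ∈ᶜ F j))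

IsIrreducible : ∀ {n m} → (Fin m → Subcube n) → Set
IsIrreducible {n} {m} F =
  ∀ (G : Subset m) → 1 < ∣ G ∣ → ∣ G ∣ < m → UnionIsSubcube F G → ⊥

IsTight : ∀ {n m} → (Fin m → Subcube n) → Set
IsTight {n} {m} F = ∀ (i : Fin n) → ∃[ j ] (F j i ≢ star)

-- Write n = m + 2 and let w_k = *…*10…0 ∈ {0,1,*}^m have its last fixed 1 at position k.
-- The family 10*…*, *10…0, 000…0, 0*w_k, 11w_k (k < m) sorts each point by its first two
-- bits and the position of its last 1 among the others, so it is a partition of size
-- 2m + 3 = 2n - 1 in which every coordinate is fixed somewhere. If a subfamily G has a
-- subcube s as union, every member meeting s lies inside s. A case analysis on the first
-- two symbols of s, driven by the corresponding description of such subcubes for the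
-- partition {w_k} ∪ {0…0} of {0,1}^m, shows that s is the whole cube or a single member,
-- contradicting 1 < |G| < 2n - 1.
module Submission where

open import Defs
open import Data.Nat using (ℕ; zero; suc; _+_; _≤_; _*_; _∸_; s≤s; z≤n)
open import Data.Nat.Properties using (<⇒≱)
open import Data.Bool using (Bool; true; false)
open import Data.Maybe using (Maybe; just; nothing)
open import Data.Fin using (Fin; zero; suc; splitAt; _↑ˡ_; _↑ʳ_)
open import Data.Fin.Properties using (∀-cons; splitAt-↑ˡ; splitAt-↑ʳ; splitAt⁻¹-↑ˡ; splitAt⁻¹-↑ʳ)
open import Data.Fin.Subset as Subset using (Subset; _∈_; _⊆_; ⁅_⁆; ∣_∣)
open import Data.Fin.Subset.Properties using (∣⊤∣≡n; ∣⁅x⁆∣≡1; x∈⁅x⁆; p⊆q⇒∣p∣≤∣q∣)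
open import Data.Vec.Functional using (_∷_; replicate; tail)
open import Data.Product using (Σ; _×_; _,_; proj₁; proj₂; ∃-syntax)
open import Data.Sum using (_⊎_; inj₁; inj₂; [_,_]′; map; map₂)
open import Data.Unit using (⊤; tt)
open import Data.Empty using (⊥-elim)
open import Relation.Nullary using (¬_)
open import Function.Base using (_∘_; case_of_)
open import Function.Bundles using (_⇔_; _↔_; Equivalence; Inverse; mk↔ₛ′)
open import Relation.Binary.PropositionalEquality
  using (_≡_; _≢_; _≗_; refl; sym; trans; cong; cong-app; subst)

private
  variable
    m n N : ℕ
    L : Set

O I : Sym
O = bit false
I = bit true

infix 4 _≍_ _⊑_ _≍ᶜ_ _⊑ᶜ_

-- As relations between subcubes: c ≍ s when they meet, c ⊑ s when c lies inside s.
_≍_ : Sym → Sym → Set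
bit a ≍ bit b = a ≡ b
bit a ≍ star  = ⊤
star  ≍ s     = ⊤

_⊑_ : Sym → Sym → Set
c ⊑ s = s ≡ star ⊎ s ≡ c

_≍ᶜ_ _⊑ᶜ_ : Subcube n → Subcube n → Set
c ≍ᶜ s = ∀ i → c i ≍ s i
c ⊑ᶜ s = ∀ i → c i ⊑ s i

≍-star : ∀ c → c ≍ star
≍-star (bit a) = tt
≍-star star    = tt

Full : Subcube n → Set
Full s = ∀ i → s i ≡ star

Full⇒≍ᶜ : ∀ {c s : Subcube n} → Full s → c ≍ᶜ s
Full⇒≍ᶜ full i = subst (_ ≍_) (sym (full i)) (≍-star _)

Saturated : (L → Subcube n) → Subcube n → Set
Saturated c s = ∀ l → c l ≍ᶜ s → c l ⊑ᶜ s

fill : Bool → Sym → Bool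
fill _ (bit a) = a
fill b star    = b

fill-matches : ∀ b c → MatchesSym (fill b c) c
fill-matches b (bit a) = refl
fill-matches b star    = tt

corner : Bool → Subcube n → Point n
corner b c i = fill b (c i)

corner-∈ : ∀ b (c : Subcube n) → corner b c ∈ᶜ c
corner-∈ b c i = fill-matches b (c i)

≍ᶜ⇒meet : {c s : Subcube n} → c ≍ᶜ s → ∃[ x ] (x ∈ᶜ c × x ∈ᶜ s)
≍ᶜ⇒meet {c = c} {s} c≍s =
  (λ i → meet (c i) (s i)) , (λ i → meet-∈ˡ (c i) (s i)) , (λ i → meet-∈ʳ (c i) (s i) (c≍s i))
  where
  meet : Sym → Sym → Bool
  meet (bit a) _       = a
  meet star    (bit b) = b
  meet star    star    = false
  meet-∈ˡ : ∀ a b → MatchesSym (meet a b) a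
  meet-∈ˡ (bit a) b = refl
  meet-∈ˡ star    b = tt
  meet-∈ʳ : ∀ a b → a ≍ b → MatchesSym (meet a b) b
  meet-∈ʳ (bit a) (bit b) a≡b = a≡b
  meet-∈ʳ (bit a) star    _   = tt
  meet-∈ʳ star    (bit b) _   = refl
  meet-∈ʳ star    star    _   = tt

-- Containment is decided by the two extreme corners.
⊆⇒⊑ᶜ : {c s : Subcube n} → (∀ x → x ∈ᶜ c → x ∈ᶜ s) → c ⊑ᶜ s
⊆⇒⊑ᶜ {c = c} {s} c⊆s i =
  corners-⊑ (c i) (s i) (c⊆s _ (corner-∈ false c) i) (c⊆s _ (corner-∈ true c) i)
  where
  corners-⊑ : ∀ a b → MatchesSym (fill false a) b → MatchesSym (fill true a) b → a ⊑ b
  corners-⊑ a       star    _ _ = inj₁ refl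
  corners-⊑ (bit a) (bit b) p _ = inj₂ (cong bit (sym p))
  corners-⊑ star    (bit b) refl ()

module _ {F : Fin N → Subcube n} (partition : IsSubcubePartition F) where

  partition-unique : ∀ {x j k} → x ∈ᶜ F j → x ∈ᶜ F k → j ≡ k
  partition-unique {x} x∈Fj x∈Fk with partition x
  ... | _ , _ , unique = trans (unique _ x∈Fj) (sym (unique _ x∈Fk))

  module _ {G : Subset N} {s : Subcube n}
           (union : ∀ x → (x ∈ᶜ s) ⇔ (∃[ j ] (j ∈ G × x ∈ᶜ F j))) where
    open Equivalence

    ∈⇒⊑-union : ∀ {j} → j ∈ G → F j ⊑ᶜ s
    ∈⇒⊑-union j∈G = ⊆⇒⊑ᶜ λ x x∈Fj → from (union x) (_ , j∈G , x∈Fj)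

    ≍-union⇒∈ : ∀ {j} → F j ≍ᶜ s → j ∈ G
    ≍-union⇒∈ {j} Fj≍s with ≍ᶜ⇒meet Fj≍s
    ... | x , x∈Fj , x∈s with to (union x) x∈s
    ... | k , k∈G , x∈Fk = subst (_∈ G) (partition-unique x∈Fk x∈Fj) k∈G

    union-saturated : Saturated F s
    union-saturated j = ∈⇒⊑-union ∘ ≍-union⇒∈

  -- A saturated union contains every member if it is the whole cube, and only that
  -- member if it is a member.
  irreducible-if-saturated-trivial :
    (∀ s → Saturated F s → Full s ⊎ ∃[ j ] s ≗ F j) → IsIrreducible F
  irreducible-if-saturated-trivial trivial G 1<∣G∣ ∣G∣<N (s , union)
    with trivial s (union-saturated union)
  ... | inj₁ full = <⇒≱ ∣G∣<N (subst (_≤ ∣ G ∣) (∣⊤∣≡n N) (p⊆q⇒∣p∣≤∣q∣ ⊤⊆G))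
    where
    ⊤⊆G : Subset.⊤ ⊆ G
    ⊤⊆G _ = ≍-union⇒∈ union (Full⇒≍ᶜ full)
  ... | inj₂ (l , s≗Fl) = <⇒≱ 1<∣G∣ (subst (∣ G ∣ ≤_) (∣⁅x⁆∣≡1 l) (p⊆q⇒∣p∣≤∣q∣ G⊆⁅l⁆))
    where
    G⊆⁅l⁆ : G ⊆ ⁅ l ⁆
    G⊆⁅l⁆ {j} j∈G =
      subst (_∈ ⁅ l ⁆) (sym (partition-unique (corner-∈ false (F j)) corner∈Fl)) (x∈⁅x⁆ l)
      where
      corner∈Fl : corner false (F j) ∈ᶜ F l
      corner∈Fl i = subst (MatchesSym _) (s≗Fl i)
        (Equivalence.from (union _) (j , j∈G , corner-∈ false (F j)) i)

module _ (ι : Fin N ↔ L) {c : L → Subcube n} where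
  open Inverse ι

  c∘to∘from≡c : ∀ l → c (to (from l)) ≡ c l
  c∘to∘from≡c l = cong c (strictlyInverseˡ l)

  partition-from-classifier : (label : Point n → L) → (∀ x → x ∈ᶜ c (label x)) →
    (∀ {x l} → x ∈ᶜ c l → label x ≡ l) → IsSubcubePartition (c ∘ to)
  partition-from-classifier label ∈-label label-unique x =
    from (label x) ,
    subst (x ∈ᶜ_) (sym (c∘to∘from≡c (label x))) (∈-label x) ,
    λ k x∈ → sym (trans (cong from (label-unique x∈)) (strictlyInverseʳ k))

  irreducible-reindexed : IsSubcubePartition (c ∘ to) →
    (∀ s → Saturated c s → Full s ⊎ ∃[ l ] s ≗ c l) → IsIrreducible (c ∘ to)
  irreducible-reindexed partition trivial = irreducible-if-saturated-trivial partition λ s sat →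
    map₂ (λ { (l , s≗cl) → from l , λ i → trans (s≗cl i) (sym (cong-app (c∘to∘from≡c l) i)) })
      (trivial s λ l → subst (λ d → d ≍ᶜ s → d ⊑ᶜ s) (c∘to∘from≡c l) (sat (from l)))

  tight-reindexed : (∀ i → ∃[ l ] c l i ≢ star) → IsTight (c ∘ to)
  tight-reindexed fixed i with fixed i
  ... | l , cli≢star = from l , subst (λ d → d i ≢ star) (sym (c∘to∘from≡c l)) cli≢star

zeros : Subcube m
zeros = replicate _ O

stars : Subcube m
stars = replicate _ star

lastOneAt : Fin m → Subcube m
lastOneAt zero    = I ∷ zeros
lastOneAt (suc k) = star ∷ lastOneAt k

chain : Maybe (Fin m) → Subcube m
chain nothing  = zeros
chain (just k) = lastOneAt k

lastOne : Point m → Maybe (Fin m)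
lastOne {zero}  y = nothing
lastOne {suc m} y = cons (y zero) (lastOne (y ∘ suc))
  where
  cons : Bool → Maybe (Fin m) → Maybe (Fin (suc m))
  cons _     (just k) = just (suc k)
  cons true  nothing  = just zero
  cons false nothing  = nothing

∈-chain-lastOne : ∀ (y : Point m) → y ∈ᶜ chain (lastOne y)
∈-chain-lastOne {zero}  y ()
∈-chain-lastOne {suc m} y with lastOne (y ∘ suc) | ∈-chain-lastOne (y ∘ suc)
... | just k  | y'∈ = ∀-cons tt y'∈
... | nothing | y'∈ with y zero in y₀
...   | true  = ∀-cons y₀ y'∈
...   | false = ∀-cons y₀ y'∈

∈-chain⇒lastOne : ∀ {y : Point m} c → y ∈ᶜ chain c → lastOne y ≡ c
∈-chain⇒lastOne {zero}  nothing         _   = refl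
∈-chain⇒lastOne {suc m} nothing         y∈  rewrite y∈ zero | ∈-chain⇒lastOne nothing (y∈ ∘ suc) = refl
∈-chain⇒lastOne {suc m} (just zero)    y∈  rewrite y∈ zero | ∈-chain⇒lastOne nothing (y∈ ∘ suc) = refl
∈-chain⇒lastOne {suc m} (just (suc k)) y∈  rewrite ∈-chain⇒lastOne (just k) (y∈ ∘ suc) = refl

≗zeros⇒≍ : ∀ {t : Subcube m} → t ≗ zeros → zeros ≍ᶜ t
≗zeros⇒≍ t≗0 i = subst (O ≍_) (sym (t≗0 i)) refl

≭I⇒≡O : ∀ s → ¬ I ≍ s → s ≡ O
≭I⇒≡O (bit false) _   = refl
≭I⇒≡O (bit true)  I≭s = ⊥-elim (I≭s refl)
≭I⇒≡O star        I≭s = ⊥-elim (I≭s tt)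

star⊑⇒≡star : ∀ {s} → star ⊑ s → s ≡ star
star⊑⇒≡star (inj₁ s≡star) = s≡star
star⊑⇒≡star (inj₂ s≡star) = s≡star

chain-avoiding : ∀ (t : Subcube m) → (∀ k → ¬ lastOneAt k ≍ᶜ t) → t ≗ zeros
chain-avoiding {suc m} t avoid = ∀-cons t₀≡O t'≗0
  where
  t'≗0 : t ∘ suc ≗ zeros
  t'≗0 = chain-avoiding (t ∘ suc) λ k → avoid (suc k) ∘ ∀-cons tt
  t₀≡O : t zero ≡ O
  t₀≡O = ≭I⇒≡O (t zero) λ I≍t₀ → avoid zero (∀-cons I≍t₀ (≗zeros⇒≍ t'≗0))

chain-saturated : ∀ (t : Subcube m) → Saturated lastOneAt t →
                  zeros ≍ᶜ t ⊎ ∃[ k ] t ≗ lastOneAt k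
chain-saturated {zero}  t _   = inj₁ λ ()
chain-saturated {suc m} t sat with t zero in t₀
... | star with chain-saturated (t ∘ suc) (λ k c → sat (suc k) (∀-cons tt c) ∘ suc)
...   | inj₁ 0≍t'        = inj₁ (∀-cons (subst (O ≍_) (sym t₀) tt) 0≍t')
...   | inj₂ (k , t'≗ck) = inj₂ (suc k , ∀-cons t₀ t'≗ck)
chain-saturated {suc m} t sat | bit b = head-fixed b t₀
  where
  -- A tail compatible with some lastOneAt k would force t zero to be a star.
  t'≗0 : t ∘ suc ≗ zeros
  t'≗0 = chain-avoiding (t ∘ suc) λ k c →
    case trans (sym t₀) (star⊑⇒≡star (sat (suc k) (∀-cons tt c) zero)) of λ ()
  head-fixed : ∀ b → t zero ≡ bit b → zeros ≍ᶜ t ⊎ ∃[ k ] t ≗ lastOneAt k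
  head-fixed false t₀≡O = inj₁ (≗zeros⇒≍ (∀-cons t₀≡O t'≗0))
  head-fixed true  t₀≡I = inj₂ (zero , ∀-cons t₀≡I t'≗0)

data Label (m : ℕ) : Set where
  D E Z : Label m
  A C   : Fin m → Label m

cube : Label m → Subcube (2 + m)
cube D     = I    ∷ O    ∷ stars
cube E     = star ∷ I    ∷ zeros
cube Z     = O    ∷ O    ∷ zeros
cube (A k) = O    ∷ star ∷ lastOneAt k
cube (C k) = I    ∷ I    ∷ lastOneAt k

classify : Bool → Bool → Maybe (Fin m) → Label m
classify true  false _        = D
classify true  true  (just k) = C k
classify true  true  nothing  = E
classify false _     (just k) = A k
classify false true  nothing  = E
classify false false nothing  = Z

label : Point (2 + m) → Label m
label x = classify (x zero) (x (suc zero)) (lastOne (tail (tail x)))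

∈-cube-label : ∀ (x : Point (2 + m)) → x ∈ᶜ cube (label x)
∈-cube-label x with x zero in x₀ | x (suc zero) in x₁
                  | lastOne (tail (tail x)) | ∈-chain-lastOne (tail (tail x))
... | true  | false | _       | _  = ∀-cons x₀ (∀-cons x₁ λ _ → tt)
... | true  | true  | just k  | y∈ = ∀-cons x₀ (∀-cons x₁ y∈)
... | true  | true  | nothing | y∈ = ∀-cons tt (∀-cons x₁ y∈)
... | false | _     | just k  | y∈ = ∀-cons x₀ (∀-cons tt y∈)
... | false | true  | nothing | y∈ = ∀-cons tt (∀-cons x₁ y∈)
... | false | false | nothing | y∈ = ∀-cons x₀ (∀-cons x₁ y∈)

∈-cube⇒label : ∀ {x : Point (2 + m)} l → x ∈ᶜ cube l → label x ≡ l
∈-cube⇒label D     x∈ rewrite x∈ zero | x∈ (suc zero) = refl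
∈-cube⇒label {x = x} E x∈
  rewrite x∈ (suc zero) | ∈-chain⇒lastOne nothing (λ i → x∈ (suc (suc i))) with x zero
... | true  = refl
... | false = refl
∈-cube⇒label Z     x∈
  rewrite x∈ zero | x∈ (suc zero) | ∈-chain⇒lastOne nothing (λ i → x∈ (suc (suc i))) = refl
∈-cube⇒label (A k) x∈ rewrite x∈ zero | ∈-chain⇒lastOne (just k) (λ i → x∈ (suc (suc i))) = refl
∈-cube⇒label (C k) x∈
  rewrite x∈ zero | x∈ (suc zero) | ∈-chain⇒lastOne (just k) (λ i → x∈ (suc (suc i))) = refl

module _ {a b : Sym} {t : Subcube m} (sat : Saturated cube (a ∷ b ∷ t)) where

  saturated-D : I ≍ a → O ≍ b → Full t
  saturated-D I≍a O≍b j = star⊑⇒≡star (sat D (∀-cons I≍a (∀-cons O≍b λ _ → tt)) (suc (suc j)))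

  saturated-E : I ≍ b → zeros ≍ᶜ t → a ≡ star
  saturated-E I≍b 0≍t = star⊑⇒≡star (sat E (∀-cons tt (∀-cons I≍b 0≍t)) zero)

  saturated-A : ∀ k → O ≍ a → lastOneAt k ≍ᶜ t → b ≡ star × lastOneAt k ⊑ᶜ t
  saturated-A k O≍a c≍t = star⊑⇒≡star (A⊑s (suc zero)) , λ j → A⊑s (suc (suc j))
    where
    A⊑s : cube (A k) ⊑ᶜ (a ∷ b ∷ t)
    A⊑s = sat (A k) (∀-cons O≍a (∀-cons tt c≍t))

  saturated-A-zeros : O ≍ a → b ≢ star → t ≗ zeros
  saturated-A-zeros O≍a b≢star = chain-avoiding t λ k c → b≢star (proj₁ (saturated-A k O≍a c))

  saturated-C : I ≍ a → I ≍ b → Saturated lastOneAt t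
  saturated-C I≍a I≍b k c≍t j = sat (C k) (∀-cons I≍a (∀-cons I≍b c≍t)) (suc (suc j))

cube-saturated-trivial-∷ : ∀ a b (t : Subcube (suc m)) → Saturated cube (a ∷ b ∷ t) →
                           Full (a ∷ b ∷ t) ⊎ ∃[ l ] (a ∷ b ∷ t) ≗ cube l
cube-saturated-trivial-∷ (bit false) (bit false) t sat =
  inj₂ (Z , ∀-cons refl (∀-cons refl (saturated-A-zeros sat refl λ ())))
cube-saturated-trivial-∷ (bit false) star t sat
  with chain-saturated t (λ k → proj₂ ∘ saturated-A sat k refl)
... | inj₁ 0≍t         = case saturated-E sat tt 0≍t of λ ()
... | inj₂ (k , t≗wk) = inj₂ (A k , ∀-cons refl (∀-cons refl t≗wk))
cube-saturated-trivial-∷ (bit false) (bit true) t sat =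
  case saturated-E sat refl (≗zeros⇒≍ (saturated-A-zeros sat refl λ ())) of λ ()
cube-saturated-trivial-∷ (bit true) (bit false) t sat =
  inj₂ (D , ∀-cons refl (∀-cons refl (saturated-D sat refl refl)))
cube-saturated-trivial-∷ (bit true) star t sat =
  case saturated-E sat tt (Full⇒≍ᶜ (saturated-D sat refl tt)) of λ ()
cube-saturated-trivial-∷ (bit true) (bit true) t sat with chain-saturated t (saturated-C sat refl refl)
... | inj₁ 0≍t         = case saturated-E sat refl 0≍t of λ ()
... | inj₂ (k , t≗wk) = inj₂ (C k , ∀-cons refl (∀-cons refl t≗wk))
cube-saturated-trivial-∷ star (bit false) t sat =
  case proj₁ (saturated-A sat zero tt (Full⇒≍ᶜ (saturated-D sat tt refl))) of λ ()
cube-saturated-trivial-∷ star star t sat =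
  inj₁ (∀-cons refl (∀-cons refl (saturated-D sat tt tt)))
cube-saturated-trivial-∷ star (bit true) t sat =
  inj₂ (E , ∀-cons refl (∀-cons refl (saturated-A-zeros sat tt λ ())))

saturated-resp-≗ : ∀ {c : L → Subcube n} {s s′} → s ≗ s′ → Saturated c s → Saturated c s′
saturated-resp-≗ s≗s′ sat l c≍s′ i =
  subst (_ ⊑_) (s≗s′ i) (sat l (λ j → subst (_ ≍_) (sym (s≗s′ j)) (c≍s′ j)) i)

cube-saturated-trivial : ∀ (s : Subcube (3 + m)) → Saturated cube s → Full s ⊎ ∃[ l ] s ≗ cube l
cube-saturated-trivial s sat =
  map (λ full i → trans (s≗∷ i) (full i)) (λ { (l , ∷≗cl) → l , λ i → trans (s≗∷ i) (∷≗cl i) })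
    (cube-saturated-trivial-∷ (s zero) (s (suc zero)) (tail (tail s)) (saturated-resp-≗ s≗∷ sat))
  where
  s≗∷ : s ≗ (s zero ∷ s (suc zero) ∷ tail (tail s))
  s≗∷ = ∀-cons refl (∀-cons refl λ _ → refl)

-- The index type reduces to Fin (suc (m + (2 + (m + 0)))), read as D, A k, E, Z, C k.
fin↔label : Fin (2 * (2 + m) ∸ 1) ↔ Label m
fin↔label {m} = mk↔ₛ′ toLabel fromLabel toLabel∘fromLabel fromLabel∘toLabel
  where
  toLabel : Fin (2 * (2 + m) ∸ 1) → Label m
  toLabel zero    = D
  toLabel (suc r) = [ A , rest ]′ (splitAt m r)
    where
    rest : Fin (2 + (m + 0)) → Label m
    rest zero           = E
    rest (suc zero)     = Z
    rest (suc (suc r′)) = [ C , (λ ()) ]′ (splitAt m r′)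

  fromLabel : Label m → Fin (2 * (2 + m) ∸ 1)
  fromLabel D     = zero
  fromLabel (A k) = suc (k ↑ˡ _)
  fromLabel E     = suc (m ↑ʳ zero)
  fromLabel Z     = suc (m ↑ʳ suc zero)
  fromLabel (C k) = suc (m ↑ʳ suc (suc (k ↑ˡ 0)))

  toLabel∘fromLabel : ∀ l → toLabel (fromLabel l) ≡ l
  toLabel∘fromLabel D     = refl
  toLabel∘fromLabel (A k) rewrite splitAt-↑ˡ m k (2 + (m + 0)) = refl
  toLabel∘fromLabel E     rewrite splitAt-↑ʳ m (2 + (m + 0)) zero = refl
  toLabel∘fromLabel Z     rewrite splitAt-↑ʳ m (2 + (m + 0)) (suc zero) = refl
  toLabel∘fromLabel (C k)
    rewrite splitAt-↑ʳ m (2 + (m + 0)) (suc (suc (k ↑ˡ 0))) | splitAt-↑ˡ m k 0 = refl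

  fromLabel∘toLabel : ∀ r → fromLabel (toLabel r) ≡ r
  fromLabel∘toLabel zero = refl
  fromLabel∘toLabel (suc r) with splitAt m r in split
  ... | inj₁ k          = cong suc (splitAt⁻¹-↑ˡ split)
  ... | inj₂ zero       = cong suc (splitAt⁻¹-↑ʳ split)
  ... | inj₂ (suc zero) = cong suc (splitAt⁻¹-↑ʳ split)
  ... | inj₂ (suc (suc r′)) with splitAt m r′ in split′
  ...   | inj₁ k =
    cong suc (trans (cong (λ i → m ↑ʳ suc (suc i)) (splitAt⁻¹-↑ˡ split′)) (splitAt⁻¹-↑ʳ split))

lastOneAt-self : ∀ (k : Fin m) → lastOneAt k k ≡ I
lastOneAt-self zero    = refl
lastOneAt-self (suc k) = lastOneAt-self k

cube-fixes : ∀ (i : Fin (2 + m)) → ∃[ l ] cube l i ≢ star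
cube-fixes zero          = D , λ ()
cube-fixes (suc zero)    = D , λ ()
cube-fixes (suc (suc k)) = A k , λ Ak≡star → case trans (sym (lastOneAt-self k)) Ak≡star of λ ()

theorem2p20 : ∀ (n : ℕ) → 3 ≤ n →
    Σ (Fin (2 * n ∸ 1) → Subcube n) λ F →
      IsSubcubePartition F × IsIrreducible F × IsTight F
theorem2p20 (suc (suc (suc m))) (s≤s (s≤s (s≤s z≤n))) =
  cube ∘ Inverse.to fin↔label ,
  partition ,
  irreducible-reindexed fin↔label partition cube-saturated-trivial ,
  tight-reindexed fin↔label cube-fixes
  where
  partition : IsSubcubePartition (cube ∘ Inverse.to fin↔label)
  partition = partition-from-classifier fin↔label label ∈-cube-label (∈-cube⇒label _)
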